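{- Let $G$ be a finite simple connected graph with weights $a,b:V(G)\to\mathbb{R}^+$, let $c\in V(G)$ and $C=[c]_S=\{c_1,\ldots,c_k\}$. Let $G'=G\setminus(C\setminus\{c\})$ and define $a',b':V(G')\to\mathbb{R}^+$ by $a'(c)=\sum_{x\in C}a(x)$, $b'(c)=\sum_{x\in C}b(x)$, and $a'(x)=a(x)$, $b'(x)=b(x)$ for $x\notin C$. Then $$W(G,a,b)=W(G',a',b')+\sum_{\{c_i,c_j\}\subseteq C}\left(a(c_i)b(c_j)+a(c_j)b(c_i)\right).$$
   Context: Vertices $x,y$ are in relation $S$ if $N[x]=N[y]$, where $N[x]=N(x)\cup\{x\}$ is the closed neighbourhood; $[x]_S$ is the $S$-class of $x$. $W(H,a,b)=\sum_{\{u,v\}\subseteq V(H)}(a(u)b(v)+a(v)b(u))d_H(u,v)$, sum over unordered pairs of distinct vertices; the final sum in the claim is over unordered pairs of distinct elements of $C$. -}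

module Defs where

open import Level using (Level)
open import Data.Nat using (ℕ; zero; suc; _≤_)
open import Data.Fin using (Fin; zero; suc; _<_; _<?_)
open import Data.Fin.Properties using (all?; _≟_)
open import Data.Bool using (Bool; true; false)
open import Data.Product using (_×_; _,_; Σ)
open import Data.Sum using (_⊎_)
open import Data.Unit using (⊤; tt)
open import Relation.Nullary using (¬_; Dec; yes; no)
open import Relation.Nullary.Decidable.Core using (_×-dec_; _⊎-dec_; _→-dec_; ¬?)
open import Relation.Binary.PropositionalEquality using (_≡_; refl)
open import Algebra.Bundles using (CommutativeSemiring)

record Graph (n : ℕ) : Set where
  field
    adj    : Fin n → Fin n → Bool
    symm   : ∀ u v → adj u v ≡ adj v u
    irrefl : ∀ u → adj u u ≡ false

open Graph public

Adj : ∀ {n} → Graph n → Fin n → Fin n → Set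
Adj G u v = adj G u v ≡ true

Adj? : ∀ {n} (G : Graph n) u v → Dec (Adj G u v)
Adj? G u v with adj G u v
... | true  = yes refl
... | false = no (λ ())

-- Walks of length k from u to v, all of whose vertices satisfy P
-- (P = the vertex set of an induced subgraph).
data Walk {n} (G : Graph n) (P : Fin n → Set) : Fin n → Fin n → ℕ → Set where
  here : ∀ {u} → P u → Walk G P u u 0
  step : ∀ {u w v k} → P u → Adj G u w → Walk G P w v k → Walk G P u v (suc k)

IsDist : ∀ {n} → Graph n → (Fin n → Set) → Fin n → Fin n → ℕ → Set
IsDist G P u v d = Walk G P u v d × (∀ k → Walk G P u v k → d ≤ k)

AllV : ∀ {n} → Fin n → Set
AllV _ = ⊤

Connected : ∀ {n} → Graph n → Set
Connected G = ∀ u v → Σ ℕ (Walk G AllV u v)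

InClosedNbhd : ∀ {n} → Graph n → Fin n → Fin n → Set
InClosedNbhd G x z = Adj G z x ⊎ z ≡ x

S : ∀ {n} → Graph n → Fin n → Fin n → Set
S G x y = ∀ z → (InClosedNbhd G x z → InClosedNbhd G y z)
               × (InClosedNbhd G y z → InClosedNbhd G x z)

S? : ∀ {n} (G : Graph n) x y → Dec (S G x y)
S? G x y = all? (λ z → ((Adj? G z x ⊎-dec (z ≟ x)) →-dec (Adj? G z y ⊎-dec (z ≟ y)))
                   ×-dec ((Adj? G z y ⊎-dec (z ≟ y)) →-dec (Adj? G z x ⊎-dec (z ≟ x))))

InClass : ∀ {n} → Graph n → Fin n → Fin n → Set
InClass G c x = S G c x

-- vertex set of G' = G \ (C \ {c})
Keep : ∀ {n} → Graph n → Fin n → Fin n → Set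
Keep G c x = ¬ (InClass G c x × ¬ (x ≡ c))

Keep? : ∀ {n} (G : Graph n) c x → Dec (Keep G c x)
Keep? G c x = ¬? (S? G c x ×-dec ¬? (x ≟ c))

module Weighted {ℓ₁ ℓ₂ : Level} (R : CommutativeSemiring ℓ₁ ℓ₂) where
  open CommutativeSemiring R using (Carrier; 0#; 1#; _+_; _*_)

  sumF : ∀ n → (Fin n → Carrier) → Carrier
  sumF zero    f = 0#
  sumF (suc n) f = f zero + sumF n (λ i → f (suc i))

  _·_ : ℕ → Carrier → Carrier
  zero  · x = 0#
  suc k · x = x + (k · x)

  -- sum over unordered pairs {i,j} of distinct vertices (taken as i < j)
  -- with both i and j satisfying P
  pairSum : ∀ {n} {P : Fin n → Set} → (∀ x → Dec (P x))
          → (Fin n → Fin n → Carrier) → Carrier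
  pairSum {n} P? f = sumF n (λ j → sumF n (λ i → term i j))
    where
    term : Fin n → Fin n → Carrier
    term i j with i <? j | P? i | P? j
    ... | yes _ | yes _ | yes _ = f i j
    ... | _     | _     | _     = 0#

  -- W(H,a,b) for H the subgraph of G induced by P, with distance function d of H
  W : ∀ {n} {P : Fin n → Set} → (∀ x → Dec (P x))
    → (d : Fin n → Fin n → ℕ) → (a b : Fin n → Carrier) → Carrier
  W P? d a b = pairSum P? (λ u v → (a u * b v + a v * b u) * (d u v · 1#))

  merge : ∀ {n} (G : Graph n) (c : Fin n) → (Fin n → Carrier) → Fin n → Carrier
  merge {n} G c a x with x ≟ c
  ... | yes _ = sumF n (λ y → sel y)
    where
    sel : Fin n → Carrier
    sel y with S? G c y
    ... | yes _ = a y
    ... | no  _ = 0#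
  ... | no  _ = a x

-- Two vertices of C = [c]_S are adjacent, and a walk leaving one of them can start from any
-- other instead, so every vertex outside C is equidistant from all of C. Hence collapsing C onto c
-- preserves the distance between vertices with distinct images, and distinct vertices with the
-- same image lie in C at distance 1. Writing W as a sum over ordered pairs, the pairs with
-- distinct images sum to W(G′,a′,b′), because a′ and b′ are the sums of a and b over the fibres
-- of the collapse, and the pairs inside C give the correction term.
module Submission where

open import Defs
open import Level using (Level)
open import Data.Nat using (ℕ)
open import Data.Fin using (Fin)
open import Data.Fin.Properties using (all?)
open import Data.Unit using (tt)
open import Relation.Nullary using (yes)
open import Algebra.Bundles using (CommutativeSemiring)

open import Data.Nat as ℕ using (suc; _≤_; z≤n; s≤s)
open import Data.Nat.Properties using (≤-refl; ≤-trans; ≤-antisym; n≤1+n; m≤n⇒m≤1+n)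
open import Data.Fin using (zero; suc; _<?_)
open import Data.Fin.Properties using (_≟_; suc-injective; <-cmp; <⇒≢)
open import Data.Product using (_×_; _,_; proj₁; proj₂; Σ; swap)
open import Data.Sum using (_⊎_; inj₁; inj₂)
open import Function using (id; _∘_)
open import Relation.Binary using (tri<; tri≈; tri>)
open import Relation.Binary.PropositionalEquality as ≡ using (_≡_; ≢-sym)
open import Relation.Nullary using (¬_; Dec; no; contradiction)
open import Relation.Nullary.Decidable using (_×-dec_; ¬?)

module _ {n : ℕ} (G : Graph n) where

  Adj-sym : ∀ {u v} → Adj G u v → Adj G v u
  Adj-sym {u} {v} e = ≡.trans (symm G v u) e

  Walk-weaken : ∀ {P Q : Fin n → Set} → (∀ {x} → P x → Q x)
              → ∀ {u v k} → Walk G P u v k → Walk G Q u v k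
  Walk-weaken P⇒Q (here p)        = here (P⇒Q p)
  Walk-weaken P⇒Q (step p e rest) = step (P⇒Q p) e (Walk-weaken P⇒Q rest)

  Walk-snoc : ∀ {P u v w k} → Walk G P u v k → Adj G v w → P w → Walk G P u w (suc k)
  Walk-snoc (here p)        e′ pw = step p e′ (here pw)
  Walk-snoc (step p e rest) e′ pw = step p e (Walk-snoc rest e′ pw)

  Walk-reverse : ∀ {P u v k} → Walk G P u v k → Walk G P v u k
  Walk-reverse (here p)        = here p
  Walk-reverse (step p e rest) = Walk-snoc (Walk-reverse rest) (Adj-sym e) p

  Walk-length-pos : ∀ {P u v k} → Walk G P u v k → ¬ u ≡ v → 1 ≤ k
  Walk-length-pos (here _)     u≢u = contradiction ≡.refl u≢u
  Walk-length-pos (step _ _ _) _   = s≤s z≤n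

  Shortcut : (P : Fin n → Set) → Fin n → Fin n → (Q : Fin n → Set) → Fin n → Fin n → Set
  Shortcut P u v Q x y = ∀ {k} → Walk G P u v k → Σ ℕ λ k′ → k′ ≤ k × Walk G Q x y k′

  Shortcut-reverse : ∀ {P Q u v x y} → Shortcut P u v Q x y → Shortcut P v u Q y x
  Shortcut-reverse shortcut w with shortcut (Walk-reverse w)
  ... | k′ , k′≤k , w′ = k′ , k′≤k , Walk-reverse w′

  isDist-≤ : ∀ {P Q u v x y d e} → IsDist G P u v d → IsDist G Q x y e
           → Shortcut P u v Q x y → e ≤ d
  isDist-≤ (w , _) (_ , minimal) shortcut with shortcut w
  ... | k′ , k′≤d , w′ = ≤-trans (minimal k′ w′) k′≤d

  isDist-≡ : ∀ {P Q u v x y d e} → IsDist G P u v d → IsDist G Q x y e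
           → Shortcut P u v Q x y → Shortcut Q x y P u v → d ≡ e
  isDist-≡ D E s t = ≤-antisym (isDist-≤ E D t) (isDist-≤ D E s)

  isDist-sym : ∀ {P u v d e} → IsDist G P u v d → IsDist G P v u e → d ≡ e
  isDist-sym D E = isDist-≡ D E reverse reverse
    where
    reverse : ∀ {P u v} → Shortcut P u v P v u
    reverse w = _ , ≤-refl , Walk-reverse w

  isDist-Adj : ∀ {P u v d} → Adj G u v → ¬ u ≡ v → P u → P v → IsDist G P u v d → d ≡ 1
  isDist-Adj e u≢v pu pv (w , minimal) =
    ≤-antisym (minimal 1 (step pu e (here pv))) (Walk-length-pos w u≢v)

  S-refl : ∀ x → S G x x
  S-refl x z = id , id

  S-sym : ∀ {x y} → S G x y → S G y x
  S-sym sxy z = swap (sxy z)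

  S-trans : ∀ {x y w} → S G x y → S G y w → S G x w
  S-trans sxy syw z = proj₁ (syw z) ∘ proj₁ (sxy z) , proj₂ (sxy z) ∘ proj₂ (syw z)

  S-Adj : ∀ {x y} → S G x y → ¬ x ≡ y → Adj G x y
  S-Adj sxy x≢y with proj₁ (sxy _) (inj₂ ≡.refl)
  ... | inj₁ e   = e
  ... | inj₂ x≡y = contradiction x≡y x≢y

  -- The first step of a walk leaving x lies in N[x] = N[y], so it can be taken from y instead.
  twin-shortcut : ∀ {x y z} → S G x y → ¬ z ≡ x → Shortcut AllV x z AllV y z
  twin-shortcut sxy z≢x (here _) = contradiction ≡.refl z≢x
  twin-shortcut sxy z≢x (step {w = w} _ e rest) with proj₁ (sxy w) (inj₁ (Adj-sym e))
  ... | inj₁ e′  = _ , ≤-refl , step tt (Adj-sym e′) rest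
  ... | inj₂ ≡.refl = _ , n≤1+n _ , rest

  isDist-twin : ∀ {x y z d e} → S G x y → ¬ z ≡ x → ¬ z ≡ y
              → IsDist G AllV x z d → IsDist G AllV y z e → d ≡ e
  isDist-twin sxy z≢x z≢y D E =
    isDist-≡ D E (twin-shortcut sxy z≢x) (twin-shortcut (S-sym sxy) z≢y)

  module _ (c : Fin n) where

    collapse : Fin n → Fin n
    collapse x with S? G c x
    ... | yes _ = c
    ... | no  _ = x

    collapse-Keep : ∀ x → Keep G c (collapse x)
    collapse-Keep x with S? G c x
    ... | yes _  = λ (_ , c≢c) → c≢c ≡.refl
    ... | no  ¬s = ¬s ∘ proj₁

    collapse-kept : ∀ {x} → Keep G c x → collapse x ≡ x
    collapse-kept {x} kx with S? G c x | x ≟ c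
    ... | no  _ | _       = ≡.refl
    ... | yes _ | yes x≡c = ≡.sym x≡c
    ... | yes s | no  x≢c = contradiction (s , x≢c) kx

    collapse-class : ∀ {x} → S G c x → collapse x ≡ c
    collapse-class {x} sx with S? G c x
    ... | yes _ = ≡.refl
    ... | no ¬s = contradiction sx ¬s

    collapse-class⁻¹ : ∀ {x} → collapse x ≡ c → S G c x
    collapse-class⁻¹ {x} eq with S? G c x
    ... | yes s = s
    ... | no  _ = ≡.subst (S G c) (≡.sym eq) (S-refl c)

    collapse-merges-only-class : ∀ {x y} → ¬ x ≡ y → collapse x ≡ collapse y → S G c x × S G c y
    collapse-merges-only-class {x} {y} x≢y eq with S? G c x | S? G c y
    ... | yes sx | yes sy = sx , sy
    ... | yes _  | no ¬sy = contradiction (≡.subst (S G c) eq (S-refl c)) ¬sy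
    ... | no ¬sx | yes _  = contradiction (≡.subst (S G c) (≡.sym eq) (S-refl c)) ¬sx
    ... | no _   | no _   = contradiction eq x≢y

    collapse-Adj : ∀ {u w} → Adj G u w → collapse u ≡ collapse w ⊎ Adj G (collapse u) (collapse w)
    collapse-Adj {u} {w} e with S? G c u | S? G c w
    ... | yes _  | yes _  = inj₁ ≡.refl
    ... | no _   | no _   = inj₂ e
    ... | yes su | no ¬sw with proj₂ (su w) (inj₁ (Adj-sym e))
    ...   | inj₁ e′  = inj₂ (Adj-sym e′)
    ...   | inj₂ ≡.refl = contradiction (S-refl c) ¬sw
    collapse-Adj e | no ¬su | yes sw with proj₂ (sw _) (inj₁ e)
    ...   | inj₁ e′  = inj₂ e′
    ...   | inj₂ ≡.refl = contradiction (S-refl c) ¬su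

    collapse-shortcut : ∀ {u v} → Shortcut AllV u v (Keep G c) (collapse u) (collapse v)
    collapse-shortcut {u} (here _) = 0 , z≤n , here (collapse-Keep u)
    collapse-shortcut {u} (step _ e rest) with collapse-shortcut rest | collapse-Adj e
    ... | k′ , k′≤k , w′ | inj₁ eq = k′ , m≤n⇒m≤1+n k′≤k , ≡.subst (λ x → Walk G (Keep G c) x _ k′) (≡.sym eq) w′
    ... | k′ , k′≤k , w′ | inj₂ e′ = suc k′ , s≤s k′≤k , step (collapse-Keep u) e′ w′

    isDist-Keep : ∀ {x y d e} → Keep G c x → Keep G c y
                → IsDist G AllV x y d → IsDist G (Keep G c) x y e → d ≡ e
    isDist-Keep kx ky D E = isDist-≡ D E
      (≡.subst₂ (Shortcut AllV _ _ (Keep G c)) (collapse-kept kx) (collapse-kept ky) collapse-shortcut)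
      (λ w → _ , ≤-refl , Walk-weaken _ w)

    isDist-collapse : ∀ {u v d e} → ¬ collapse u ≡ collapse v
                    → IsDist G AllV u v d → IsDist G AllV (collapse u) (collapse v) e → d ≡ e
    isDist-collapse {u} {v} ρu≢ρv D E with S? G c u | S? G c v
    ... | yes _  | yes _  = contradiction ≡.refl ρu≢ρv
    ... | yes su | no ¬sv = isDist-twin (S-sym su) (¬sv ∘ λ v≡u → ≡.subst (S G c) (≡.sym v≡u) su)
                                                   (¬sv ∘ λ v≡c → ≡.subst (S G c) (≡.sym v≡c) (S-refl c)) D E
    ... | no ¬su | yes sv = isDist-≡ D E (Shortcut-reverse (twin-shortcut (S-sym sv) u≢v))
                                         (Shortcut-reverse (twin-shortcut sv u≢c))
      where
      u≢v : ¬ u ≡ v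
      u≢v u≡v = ¬su (≡.subst (S G c) (≡.sym u≡v) sv)
      u≢c : ¬ u ≡ c
      u≢c u≡c = ¬su (≡.subst (S G c) (≡.sym u≡c) (S-refl c))
    ... | no _   | no _   = isDist-≡ D E (λ w → _ , ≤-refl , w) (λ w → _ , ≤-refl , w)

Distinct : ∀ {n} → (Fin n → Set) → Fin n → Fin n → Set
Distinct P u v = P u × P v × ¬ u ≡ v

distinct-sym : ∀ {n} {P : Fin n → Set} {u v} → Distinct P u v → Distinct P v u
distinct-sym (pu , pv , u≢v) = pv , pu , ≢-sym u≢v

distinct? : ∀ {n} {P : Fin n → Set} → (∀ x → Dec (P x)) → ∀ u v → Dec (Distinct P u v)
distinct? P? u v = P? u ×-dec P? v ×-dec ¬? (u ≟ v)

module WeightedSums {ℓ₁ ℓ₂ : Level} (R : CommutativeSemiring ℓ₁ ℓ₂) where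
  open CommutativeSemiring R hiding (zero)
  open Weighted R
  open import Algebra.Properties.Semiring.Sum semiring
  open import Relation.Binary.Reasoning.Setoid setoid

  when : ∀ {p} {Q : Set p} → Dec Q → Carrier → Carrier
  when (yes _) x = x
  when (no _)  _ = 0#

  when-yes : ∀ {p} {Q : Set p} (q : Dec Q) {x} → Q → when q x ≈ x
  when-yes (yes _) _  = refl
  when-yes (no ¬q) q  = contradiction q ¬q

  when-no : ∀ {p} {Q : Set p} (q : Dec Q) {x} → ¬ Q → when q x ≈ 0#
  when-no (yes q) ¬q = contradiction q ¬q
  when-no (no _)  _  = refl

  when-+ : ∀ {p} {Q : Set p} (q : Dec Q) x y → when q (x + y) ≈ when q x + when q y
  when-+ (yes _) x y = refl
  when-+ (no _)  x y = sym (+-identityˡ 0#)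

  when-*ʳ : ∀ {p} {Q : Set p} (q : Dec Q) x y → when q x * y ≈ when q (x * y)
  when-*ʳ (yes _) x y = refl
  when-*ʳ (no _)  x y = zeroˡ y

  when-cong : ∀ {p} {Q : Set p} (q : Dec Q) {x y} → (Q → x ≈ y) → when q x ≈ when q y
  when-cong (yes q) x≈y = x≈y q
  when-cong (no _)  _   = refl

  when-when : ∀ {p q} {P : Set p} {Q : Set q} (p? : Dec P) (q? : Dec Q) {x}
            → when p? (when q? x) ≈ when (p? ×-dec q?) x
  when-when (yes _) (yes _) = refl
  when-when (yes _) (no _)  = refl
  when-when (no _)  _       = refl

  when-elim : ∀ {p} {Q : Set p} (q : Dec Q) {x y} → (Q → x ≈ y) → (¬ Q → 0# ≈ y) → when q x ≈ y
  when-elim (yes q) x≈y _   = x≈y q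
  when-elim (no ¬q) _   0≈y = 0≈y ¬q

  when-⇔ : ∀ {p q} {P : Set p} {Q : Set q} (p? : Dec P) (q? : Dec Q) {x}
         → (P → Q) → (Q → P) → when p? x ≈ when q? x
  when-⇔ (yes _) (yes _) _   _   = refl
  when-⇔ (no _)  (no _)  _   _   = refl
  when-⇔ (yes p) (no ¬q) p⇒q _   = contradiction (p⇒q p) ¬q
  when-⇔ (no ¬p) (yes q) _   q⇒p = contradiction (q⇒p q) ¬p

  sumF≡sum : ∀ n (f : Fin n → Carrier) → sumF n f ≡ sum f
  sumF≡sum ℕ.zero    f = ≡.refl
  sumF≡sum (suc n) f = ≡.cong (f zero +_) (sumF≡sum n (f ∘ suc))

  ∑∑ : ∀ {n} → (Fin n → Fin n → Carrier) → Carrier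
  ∑∑ {n} f = ∑[ u < n ] ∑[ v < n ] f u v

  ∑∑-cong : ∀ {n} {f g : Fin n → Fin n → Carrier} → (∀ u v → f u v ≈ g u v) → ∑∑ f ≈ ∑∑ g
  ∑∑-cong f≈g = sum-cong-≋ λ u → sum-cong-≋ (f≈g u)

  ∑∑-distrib-+ : ∀ {n} (f g : Fin n → Fin n → Carrier) → ∑∑ (λ u v → f u v + g u v) ≈ ∑∑ f + ∑∑ g
  ∑∑-distrib-+ f g = trans (sum-cong-≋ λ u → ∑-distrib-+ (f u) (g u)) (∑-distrib-+ (λ u → ∑[ v < _ ] f u v) _)

  ∑-zero : ∀ {n} {f : Fin n → Carrier} → (∀ x → f x ≈ 0#) → ∑[ x < n ] f x ≈ 0#
  ∑-zero {n} f≈0 = trans (sum-cong-≋ f≈0) (sum-replicate-zero n)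

  ∑-single : ∀ {n} (r : Fin n) {f : Fin n → Carrier} → (∀ x → ¬ x ≡ r → f x ≈ 0#)
           → ∑[ x < n ] f x ≈ f r
  ∑-single zero    f≈0 = trans (+-congˡ (∑-zero λ x → f≈0 (suc x) λ ())) (+-identityʳ _)
  ∑-single (suc r) f≈0 =
    trans (+-cong (f≈0 zero λ ()) (∑-single r λ x x≢r → f≈0 (suc x) (x≢r ∘ suc-injective)))
          (+-identityˡ _)

  push : ∀ {m n} → (Fin m → Fin n) → (Fin m → Carrier) → Fin n → Carrier
  push {m} r α x = ∑[ u < m ] when (r u ≟ x) (α u)

  ∑-push : ∀ {m n} (r : Fin m → Fin n) (α : Fin m → Carrier) (h : Fin n → Carrier)
         → ∑[ x < n ] (push r α x * h x) ≈ ∑[ u < m ] (α u * h (r u))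
  ∑-push {m} {n} r α h = begin
      ∑[ x < n ] (push r α x * h x)
    ≈⟨ sum-cong-≋ (λ x → *-distribʳ-sum (h x) λ u → when (r u ≟ x) (α u)) ⟩
      ∑[ x < n ] ∑[ u < m ] (when (r u ≟ x) (α u) * h x)
    ≈⟨ sum-cong-≋ (λ x → sum-cong-≋ λ u → when-*ʳ (r u ≟ x) (α u) (h x)) ⟩
      ∑[ x < n ] ∑[ u < m ] when (r u ≟ x) (α u * h x)
    ≈⟨ ∑-comm (λ x u → when (r u ≟ x) (α u * h x)) ⟩
      ∑[ u < m ] ∑[ x < n ] when (r u ≟ x) (α u * h x)
    ≈⟨ sum-cong-≋ (λ u → ∑-single (r u) λ x x≢ru → when-no (r u ≟ x) (x≢ru ∘ ≡.sym)) ⟩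
      ∑[ u < m ] when (r u ≟ r u) (α u * h (r u))
    ≈⟨ sum-cong-≋ (λ u → when-yes (r u ≟ r u) ≡.refl) ⟩
      ∑[ u < m ] (α u * h (r u)) ∎

  ∑∑-push : ∀ {m n} (r : Fin m → Fin n) (α β : Fin m → Carrier) (H : Fin n → Fin n → Carrier)
          → ∑∑ (λ x y → push r α x * (push r β y * H x y)) ≈ ∑∑ (λ u v → α u * (β v * H (r u) (r v)))
  ∑∑-push {m} {n} r α β H = begin
      ∑[ x < n ] ∑[ y < n ] (push r α x * (push r β y * H x y))
    ≈⟨ sum-cong-≋ (λ x → sym (*-distribˡ-sum (push r α x) λ y → push r β y * H x y)) ⟩
      ∑[ x < n ] (push r α x * ∑[ y < n ] (push r β y * H x y))
    ≈⟨ sum-cong-≋ (λ x → *-congˡ (∑-push r β (H x))) ⟩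
      ∑[ x < n ] (push r α x * ∑[ v < m ] (β v * H x (r v)))
    ≈⟨ ∑-push r α _ ⟩
      ∑[ u < m ] (α u * ∑[ v < m ] (β v * H (r u) (r v)))
    ≈⟨ sum-cong-≋ (λ u → *-distribˡ-sum (α u) λ v → β v * H (r u) (r v)) ⟩
      ∑[ u < m ] ∑[ v < m ] (α u * (β v * H (r u) (r v))) ∎

  ∑∑-mirror : ∀ {n} (k : Fin n → Fin n → Carrier) → (∀ i → k i i ≈ 0#)
            → ∑∑ (λ j i → when (i <? j) (k i j + k j i)) ≈ ∑∑ k
  ∑∑-mirror {n} k k-diag = begin
      ∑∑ (λ j i → when (i <? j) (k i j + k j i))
    ≈⟨ ∑∑-cong {n} (λ j i → when-+ (i <? j) _ _) ⟩
      ∑∑ (λ j i → when (i <? j) (k i j) + when (i <? j) (k j i))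
    ≈⟨ ∑∑-distrib-+ {n} _ _ ⟩
      ∑∑ (λ j i → when (i <? j) (k i j)) + ∑∑ (λ j i → when (i <? j) (k j i))
    ≈⟨ +-congˡ (∑-comm (λ j i → when (i <? j) (k j i))) ⟩
      ∑∑ (λ j i → when (i <? j) (k i j)) + ∑∑ (λ j i → when (j <? i) (k i j))
    ≈⟨ sym (∑∑-distrib-+ {n} _ _) ⟩
      ∑∑ (λ j i → when (i <? j) (k i j) + when (j <? i) (k i j))
    ≈⟨ ∑∑-cong {n} (λ j i → by-order i j) ⟩
      ∑∑ (λ j i → k i j)
    ≈⟨ ∑-comm (λ j i → k i j) ⟩
      ∑∑ k ∎
    where
    by-order : ∀ i j → when (i <? j) (k i j) + when (j <? i) (k i j) ≈ k i j
    by-order i j with <-cmp i j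
    ... | tri< i<j _ j≮i = trans (+-cong (when-yes (i <? j) i<j) (when-no (j <? i) j≮i)) (+-identityʳ _)
    ... | tri> i≮j _ j<i = trans (+-cong (when-no (i <? j) i≮j) (when-yes (j <? i) j<i)) (+-identityˡ _)
    ... | tri≈ i≮i ≡.refl _ =
      trans (+-cong (when-no (i <? i) i≮i) (when-no (i <? i) i≮i)) (trans (+-identityˡ 0#) (sym (k-diag i)))

  offDiagSum : ∀ {n} {P : Fin n → Set} → (∀ x → Dec (P x)) → (Fin n → Fin n → Carrier) → Carrier
  offDiagSum P? f = ∑∑ (λ u v → when (distinct? P? u v) (f u v))

  -- The summand of pairSum is a with-function local to its definition and cannot be named,
  -- so the left-hand side of this type is solved by unification from the use in pairSum-unfold.
  pairSum-summand : ∀ {n} {P : Fin n → Set} (P? : ∀ x → Dec (P x)) (F : Fin n → Fin n → Carrier) (i j : Fin n)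
                  → _ ≈ when (i <? j) (when (P? i) (when (P? j) (F i j)))

  pairSum-unfold : ∀ {n} {P : Fin n → Set} (P? : ∀ x → Dec (P x)) (F : Fin n → Fin n → Carrier)
                 → pairSum P? F ≈ ∑∑ (λ j i → when (i <? j) (when (P? i) (when (P? j) (F i j))))
  pairSum-unfold {n} P? F =
    trans (reflexive (sumF≡sum n _))
          (sum-cong-≋ λ j → trans (reflexive (sumF≡sum n _)) (sum-cong-≋ λ i → pairSum-summand P? F i j))

  pairSum-summand P? F i j with i <? j | P? i | P? j
  ... | yes _ | yes _ | yes _ = refl
  ... | yes _ | yes _ | no  _ = refl
  ... | yes _ | no  _ | _     = refl
  ... | no  _ | _     | _     = refl

  pairSum≈offDiagSum : ∀ {n} {P : Fin n → Set} (P? : ∀ x → Dec (P x)) {F f : Fin n → Fin n → Carrier}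
                     → (∀ u v → P u → P v → F u v ≈ f u v + f v u) → pairSum P? F ≈ offDiagSum P? f
  pairSum≈offDiagSum {n} {P} P? {F} {f} F≈f+fᵀ = begin
      pairSum P? F
    ≈⟨ pairSum-unfold P? F ⟩
      ∑∑ (λ j i → when (i <? j) (when (P? i) (when (P? j) (F i j))))
    ≈⟨ ∑∑-cong {n} (λ j i → ordered-pair i j) ⟩
      ∑∑ (λ j i → when (i <? j) (k i j + k j i))
    ≈⟨ ∑∑-mirror k (λ i → when-no (distinct? P? i i) λ (_ , _ , i≢i) → i≢i ≡.refl) ⟩
      offDiagSum P? f ∎
    where
    k : Fin n → Fin n → Carrier
    k u v = when (distinct? P? u v) (f u v)

    ordered-pair : ∀ i j → when (i <? j) (when (P? i) (when (P? j) (F i j))) ≈ when (i <? j) (k i j + k j i)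
    ordered-pair i j = when-cong (i <? j) λ i<j → begin
        when (P? i) (when (P? j) (F i j))
      ≈⟨ when-when (P? i) (P? j) ⟩
        when (P? i ×-dec P? j) (F i j)
      ≈⟨ when-⇔ (P? i ×-dec P? j) (distinct? P? i j) (λ (pi , pj) → pi , pj , <⇒≢ i<j) (λ (pi , pj , _) → pi , pj) ⟩
        when (distinct? P? i j) (F i j)
      ≈⟨ when-cong (distinct? P? i j) (λ (pi , pj , _) → F≈f+fᵀ i j pi pj) ⟩
        when (distinct? P? i j) (f i j + f j i)
      ≈⟨ when-+ (distinct? P? i j) _ _ ⟩
        k i j + when (distinct? P? i j) (f j i)
      ≈⟨ +-congˡ (when-⇔ (distinct? P? i j) (distinct? P? j i) distinct-sym distinct-sym) ⟩
        k i j + k j i ∎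

  W≈offDiagSum : ∀ {n} {P : Fin n → Set} (P? : ∀ x → Dec (P x)) (d : Fin n → Fin n → ℕ) (a b : Fin n → Carrier)
               → (∀ u v → P u → P v → d u v ≡ d v u)
               → W P? d a b ≈ offDiagSum P? (λ u v → a u * (b v * (d u v · 1#)))
  W≈offDiagSum P? d a b d-sym = pairSum≈offDiagSum P? λ u v pu pv → begin
      (a u * b v + a v * b u) * (d u v · 1#)
    ≈⟨ distribʳ _ _ _ ⟩
      a u * b v * (d u v · 1#) + a v * b u * (d u v · 1#)
    ≈⟨ +-cong (*-assoc _ _ _) (*-assoc _ _ _) ⟩
      a u * (b v * (d u v · 1#)) + a v * (b u * (d u v · 1#))
    ≡⟨ ≡.cong (λ k → a u * (b v * (d u v · 1#)) + a v * (b u * (k · 1#))) (d-sym u v pu pv) ⟩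
      a u * (b v * (d u v · 1#)) + a v * (b u * (d v u · 1#)) ∎

  -- As with pairSum-summand, the selector summed by merge is local to its definition.
  merge-selected : ∀ {n} (G : Graph n) (c : Fin n) (a : Fin n → Carrier) (y : Fin n)
                 → _ ≈ when (S? G c y) (a y)

  merge≈push : ∀ {n} (G : Graph n) (c : Fin n) (a : Fin n → Carrier) {x}
             → Keep G c x → merge G c a x ≈ push (collapse G c) a x
  merge≈push {n} G c a {x} kx with x ≟ c
  ... | yes ≡.refl =
    trans (reflexive (sumF≡sum n _))
          (sum-cong-≋ λ y → trans (merge-selected G c a y)
                                  (when-⇔ (S? G c y) (collapse G c y ≟ c) (collapse-class G c) (collapse-class⁻¹ G c)))
  ... | no x≢c = sym (trans (∑-single x outside-fibre) (when-yes (collapse G c x ≟ x) (collapse-kept G c kx)))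
    where
    outside-fibre : ∀ y → ¬ y ≡ x → when (collapse G c y ≟ x) (a y) ≈ 0#
    outside-fibre y y≢x = when-no (collapse G c y ≟ x) λ ρy≡x →
      kx (proj₂ (collapse-merges-only-class G c y≢x (≡.trans ρy≡x (≡.sym (collapse-kept G c kx)))) , x≢c)

  merge-selected G c a y with S? G c y
  ... | yes _ = refl
  ... | no  _ = refl

AllV? : ∀ {n} (x : Fin n) → Dec (AllV x)
AllV? _ = yes tt

module Contraction {ℓ₁ ℓ₂ : Level} (R : CommutativeSemiring ℓ₁ ℓ₂) {n : ℕ} (G : Graph n) (c : Fin n)
  (d : Fin n → Fin n → ℕ) (D : ∀ u v → IsDist G AllV u v (d u v))
  (d′ : Fin n → Fin n → ℕ)
  (D′ : ∀ u v → Keep G c u → Keep G c v → IsDist G (Keep G c) u v (d′ u v))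
  (a b : Fin n → CommutativeSemiring.Carrier R) where

  open CommutativeSemiring R hiding (zero)
  open Weighted R
  open WeightedSums R
  open import Relation.Binary.Reasoning.Setoid setoid

  ρ : Fin n → Fin n
  ρ = collapse G c

  δ′ : Fin n → Fin n → Carrier
  δ′ x y = when (distinct? (Keep? G c) x y) (d′ x y · 1#)

  summand : Fin n → Fin n → Carrier
  summand u v = when (distinct? AllV? u v) (a u * (b v * (d u v · 1#)))

  contracted-summand : Fin n → Fin n → Carrier
  contracted-summand u v = a u * (b v * δ′ (ρ u) (ρ v))

  class-summand : Fin n → Fin n → Carrier
  class-summand u v = when (distinct? (S? G c) u v) (a u * b v)

  W-contracted : W (Keep? G c) d′ (merge G c a) (merge G c b) ≈ ∑∑ contracted-summand
  W-contracted = begin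
      W (Keep? G c) d′ (merge G c a) (merge G c b)
    ≈⟨ W≈offDiagSum (Keep? G c) d′ _ _ (λ x y kx ky → isDist-sym G (D′ x y kx ky) (D′ y x ky kx)) ⟩
      offDiagSum (Keep? G c) (λ x y → merge G c a x * (merge G c b y * (d′ x y · 1#)))
    ≈⟨ ∑∑-cong {n} pushed ⟩
      ∑∑ (λ x y → push ρ a x * (push ρ b y * δ′ x y))
    ≈⟨ ∑∑-push ρ a b δ′ ⟩
      ∑∑ contracted-summand ∎
    where
    pushed : ∀ x y → when (distinct? (Keep? G c) x y) (merge G c a x * (merge G c b y * (d′ x y · 1#)))
                   ≈ push ρ a x * (push ρ b y * δ′ x y)
    pushed x y = when-elim (distinct? (Keep? G c) x y)
      (λ xy@(kx , ky , _) → *-cong (merge≈push G c a kx)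
                                   (*-cong (merge≈push G c b ky) (sym (when-yes (distinct? (Keep? G c) x y) xy))))
      (λ ¬xy → sym (trans (*-congˡ (trans (*-congˡ (when-no (distinct? (Keep? G c) x y) ¬xy)) (zeroʳ _)))
                          (zeroʳ _)))

  summand-separated : ∀ {u v} → ¬ ρ u ≡ ρ v → summand u v ≈ contracted-summand u v + class-summand u v
  summand-separated {u} {v} ρu≢ρv = begin
      summand u v
    ≈⟨ when-yes (distinct? AllV? u v) (tt , tt , ρu≢ρv ∘ ≡.cong ρ) ⟩
      a u * (b v * (d u v · 1#))
    ≡⟨ ≡.cong (λ k → a u * (b v * (k · 1#))) d≡d′ ⟩
      a u * (b v * (d′ (ρ u) (ρ v) · 1#))
    ≈⟨ *-congˡ (*-congˡ (sym (when-yes (distinct? (Keep? G c) (ρ u) (ρ v)) (ku , kv , ρu≢ρv)))) ⟩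
      contracted-summand u v
    ≈⟨ sym (+-identityʳ _) ⟩
      contracted-summand u v + 0#
    ≈⟨ +-congˡ (sym (when-no (distinct? (S? G c) u v) not-both-in-class)) ⟩
      contracted-summand u v + class-summand u v ∎
    where
    ku : Keep G c (ρ u)
    ku = collapse-Keep G c u
    kv : Keep G c (ρ v)
    kv = collapse-Keep G c v
    d≡d′ : d u v ≡ d′ (ρ u) (ρ v)
    d≡d′ = ≡.trans (isDist-collapse G c ρu≢ρv (D u v) (D (ρ u) (ρ v)))
                   (isDist-Keep G c ku kv (D (ρ u) (ρ v)) (D′ (ρ u) (ρ v) ku kv))
    not-both-in-class : ¬ Distinct (S G c) u v
    not-both-in-class (su , sv , _) = ρu≢ρv (≡.trans (collapse-class G c su) (≡.sym (collapse-class G c sv)))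

  contracted-summand-merged : ∀ {u v} → ρ u ≡ ρ v → contracted-summand u v ≈ 0#
  contracted-summand-merged {u} {v} ρu≡ρv =
    trans (*-congˡ (trans (*-congˡ (when-no (distinct? (Keep? G c) (ρ u) (ρ v)) λ (_ , _ , ne) → ne ρu≡ρv))
                          (zeroʳ _)))
          (zeroʳ _)

  summand-merged : ∀ {u v} → ρ u ≡ ρ v → ¬ u ≡ v → summand u v ≈ contracted-summand u v + class-summand u v
  summand-merged {u} {v} ρu≡ρv u≢v = begin
      summand u v
    ≈⟨ when-yes (distinct? AllV? u v) (tt , tt , u≢v) ⟩
      a u * (b v * (d u v · 1#))
    ≡⟨ ≡.cong (λ k → a u * (b v * (k · 1#))) (isDist-Adj G (S-Adj G (S-trans G (S-sym G su) sv) u≢v) u≢v tt tt (D u v)) ⟩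
      a u * (b v * (1# + 0#))
    ≈⟨ *-congˡ (trans (*-congˡ (+-identityʳ 1#)) (*-identityʳ _)) ⟩
      a u * b v
    ≈⟨ sym (+-identityˡ _) ⟩
      0# + a u * b v
    ≈⟨ sym (+-cong (contracted-summand-merged ρu≡ρv) (when-yes (distinct? (S? G c) u v) (su , sv , u≢v))) ⟩
      contracted-summand u v + class-summand u v ∎
    where
    su : S G c u
    su = proj₁ (collapse-merges-only-class G c u≢v ρu≡ρv)
    sv : S G c v
    sv = proj₂ (collapse-merges-only-class G c u≢v ρu≡ρv)

  summand-coincident : ∀ {u v} → u ≡ v → summand u v ≈ contracted-summand u v + class-summand u v
  summand-coincident {u} ≡.refl = begin
      summand u u
    ≈⟨ when-no (distinct? AllV? u u) (λ (_ , _ , u≢u) → u≢u ≡.refl) ⟩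
      0#
    ≈⟨ sym (+-identityˡ 0#) ⟩
      0# + 0#
    ≈⟨ sym (+-cong (contracted-summand-merged ≡.refl) (when-no (distinct? (S? G c) u u) λ (_ , _ , u≢u) → u≢u ≡.refl)) ⟩
      contracted-summand u u + class-summand u u ∎

  summand-split : ∀ u v → summand u v ≈ contracted-summand u v + class-summand u v
  summand-split u v = by-cases (ρ u ≟ ρ v) (u ≟ v)
    where
    by-cases : Dec (ρ u ≡ ρ v) → Dec (u ≡ v) → summand u v ≈ contracted-summand u v + class-summand u v
    by-cases (no ρu≢ρv) _         = summand-separated ρu≢ρv
    by-cases (yes ρu≡ρv) (no u≢v) = summand-merged ρu≡ρv u≢v
    by-cases (yes _)     (yes u≡v) = summand-coincident u≡v

  offDiagSum-split-class : offDiagSum AllV? (λ u v → a u * (b v * (d u v · 1#)))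
                         ≈ ∑∑ contracted-summand + offDiagSum (S? G c) (λ u v → a u * b v)
  offDiagSum-split-class = trans (∑∑-cong {n} summand-split) (∑∑-distrib-+ {n} _ _)

mainTheorem10 : ∀ {ℓ₁ ℓ₂ : Level} (R : CommutativeSemiring ℓ₁ ℓ₂) (n : ℕ) (G : Graph n)
    → Connected G
    → (a b : Fin n → CommutativeSemiring.Carrier R)
    → (c : Fin n)
    → (d : Fin n → Fin n → ℕ) → (∀ u v → IsDist G AllV u v (d u v))
    → (d′ : Fin n → Fin n → ℕ)
    → (∀ u v → Keep G c u → Keep G c v → IsDist G (Keep G c) u v (d′ u v))
    → CommutativeSemiring._≈_ R
        (Weighted.W R (λ _ → yes tt) d a b)
        (CommutativeSemiring._+_ R
          (Weighted.W R (Keep? G c) d′ (Weighted.merge R G c a) (Weighted.merge R G c b))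
          (Weighted.pairSum R (S? G c)
            (λ u v → CommutativeSemiring._+_ R
                       (CommutativeSemiring._*_ R (a u) (b v))
                       (CommutativeSemiring._*_ R (a v) (b u)))))
mainTheorem10 R n G _ a b c d D d′ D′ = begin
    W AllV? d a b
  ≈⟨ W≈offDiagSum AllV? d a b (λ u v _ _ → isDist-sym G (D u v) (D v u)) ⟩
    offDiagSum AllV? (λ u v → a u * (b v * (d u v · 1#)))
  ≈⟨ offDiagSum-split-class ⟩
    ∑∑ contracted-summand + offDiagSum (S? G c) (λ u v → a u * b v)
  ≈⟨ +-cong (sym W-contracted) (sym (pairSum≈offDiagSum (S? G c) λ _ _ _ _ → refl)) ⟩
    W (Keep? G c) d′ (merge G c a) (merge G c b) + pairSum (S? G c) (λ u v → a u * b v + a v * b u) ∎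
  where
  open CommutativeSemiring R hiding (zero)
  open Weighted R
  open WeightedSums R
  open Contraction R G c d D d′ D′ a b
  open import Relation.Binary.Reasoning.Setoid setoid
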